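{- For $n\ge 0$ let $$S_n=\sum_{0\le 2k\le n} q^{2k^2}\begin{bmatrix} n\\ 2k\end{bmatrix}_q,\qquad \overline{S}_n=\sum_{j\in\mathbb{Z}} q^{4j^2-j}\begin{bmatrix} n\\ \lfloor\frac{n+1}{2}\rfloor-2j\end{bmatrix}_{q^2}.$$ Then for every integer $n\ge 0$, $$S_{n+2}-(1+q)S_{n+1}+(q-q^{2n+2})S_n=0\quad\text{and}\quad \overline{S}_{n+2}-(1+q)\overline{S}_{n+1}+(q-q^{2n+2})\overline{S}_n=0.$$
   Context: $q$ is an indeterminate. For a base $p$ (here $p=q$ or $p=q^2$) and integers $n,k$, $\begin{bmatrix} n\\ k\end{bmatrix}_p$ denotes the Gaussian binomial coefficient $\frac{(p;p)_n}{(p;p)_k(p;p)_{n-k}}$ for $0\le k\le n$ and $0$ otherwise, where $(x;p)_m=(1-x)(1-xp)\cdots(1-xp^{m-1})$. -}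

module Defs where

open import Level using (Level)
open import Algebra.Bundles using (CommutativeRing)
open import Data.Nat as ℕ using (ℕ; zero; suc; _/_)
open import Data.Integer as ℤ using (ℤ; +_; -[1+_]; ∣_∣)

module _ {c ℓ : Level} (R : CommutativeRing c ℓ) where
  open CommutativeRing R

  _⊖_ : Carrier → Carrier → Carrier
  x ⊖ y = x + (- y)

  pow : Carrier → ℕ → Carrier
  pow x zero = 1#
  pow x (suc m) = x * pow x m

  -- Gaussian binomial [n over k]_p, via the q-Pascal recurrence
  -- [n+1, k+1]_p = [n, k]_p + p^(k+1) [n, k+1]_p ; zero when k > n.
  gauss : Carrier → ℕ → ℕ → Carrier
  gauss p zero zero = 1#
  gauss p zero (suc k) = 0#
  gauss p (suc n) zero = 1#
  gauss p (suc n) (suc k) = gauss p n k + pow p (suc k) * gauss p n (suc k)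

  gaussℤ : Carrier → ℕ → ℤ → Carrier
  gaussℤ p n (+ k) = gauss p n k
  gaussℤ p n -[1+ k ] = 0#

  sumTo : ℕ → (ℕ → Carrier) → Carrier
  sumTo zero f = 0#
  sumTo (suc N) f = sumTo N f + f N

  -- S_n = Σ_{0 ≤ 2k ≤ n} q^{2k²} [n, 2k]_q   (terms with 2k > n vanish)
  S : Carrier → ℕ → Carrier
  S q n = sumTo (suc n) (λ k → pow q (2 ℕ.* k ℕ.* k) * gauss q n (2 ℕ.* k))

  -- index j ranging over -n .. n ; all other j give zero terms
  jOf : ℕ → ℕ → ℤ
  jOf n i = (+ i) ℤ.- (+ n)

  Sbar : Carrier → ℕ → Carrier
  Sbar q n = sumTo (suc (2 ℕ.* n)) (λ i →
    pow q ∣ (+ 4) ℤ.* jOf n i ℤ.* jOf n i ℤ.- jOf n i ∣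
      * gaussℤ (q * q) n ((+ (suc n / 2)) ℤ.- (+ 2) ℤ.* jOf n i))

module Submission where

-- Both S and S̄ are the first component e of a solution (e, o) of
--
--   e (n+1) = e n + q^(n+1) o n,     o (n+1) = o n + q^n e n,
--
-- and eliminating o from this system gives the three-term recurrence.
-- For S the companion is the odd part o n = Σ_k q^(2k²+2k) [n, 2k+1]_q, and
-- both equations hold termwise by the second q-Pascal rule.
-- For S̄, write μ n = ⌊(n+1)/2⌋ = ⌈n/2⌉; the companion is
-- o n = Σ_j q^(4j²+3j) [n, μ n - 2j - 1]_{q²}. For even n, μ grows by one and
-- the terms obey the first q-Pascal rule, the companion term being the one at
-- j - 1; for odd n, μ stays put and the second rule applies, with the S̄-term
-- at j + 1. The exponents 4j² - j and 4j² + 3j are exactly what makes the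
-- powers of q match, and after reindexing, the few terms whose lower index
-- leaves [0, n] vanish.

open import Defs
open import Level using (Level)
open import Algebra.Bundles using (CommutativeRing)
open import Data.Product using (_×_; _,_)
open import Data.Nat as ℕ using (ℕ; zero; suc; _<_; _≤_; z≤n; s≤s; ⌊_/2⌋; ⌈_/2⌉)
import Data.Nat.Properties as ℕₚ
open import Data.Nat.DivMod using (m/n≡1+[m∸n]/n)
import Data.Nat.Tactic.RingSolver as ℕ-Solver
open import Data.Integer as ℤ using (ℤ; +_; -[1+_]; ∣_∣)
import Data.Integer.Properties as ℤₚ
import Data.Integer.Tactic.RingSolver as ℤ-Solver
open import Relation.Binary.PropositionalEquality as ≡ using (_≡_; cong; cong₂)
open import Relation.Nullary using (yes; no)
import Algebra.Properties.Group as GroupProperties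
import Algebra.Properties.AbelianGroup as AbelianGroupProperties
import Algebra.Properties.Ring as RingProperties
import Algebra.Solver.Ring.NaturalCoefficients.Default as Solver

data Parity : ℕ → Set where
  even : ∀ m → Parity (m ℕ.+ m)
  odd  : ∀ m → Parity (suc (m ℕ.+ m))

parity : ∀ n → Parity n
parity zero = even 0
parity (suc n) with parity n
... | even m = odd m
... | odd m = ≡.subst Parity (cong suc (ℕₚ.+-suc m m)) (even (suc m))

n/2≡⌊n/2⌋ : ∀ n → n ℕ./ 2 ≡ ⌊ n /2⌋
n/2≡⌊n/2⌋ 0 = ≡.refl
n/2≡⌊n/2⌋ 1 = ≡.refl
n/2≡⌊n/2⌋ (suc (suc n)) =
  ≡.trans (m/n≡1+[m∸n]/n {suc (suc n)} {2} (s≤s (s≤s z≤n))) (cong suc (n/2≡⌊n/2⌋ n))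

1+m≡⌈1+m+m/2⌉ : ∀ m → suc m ≡ ⌈ suc (m ℕ.+ m) /2⌉
1+m≡⌈1+m+m/2⌉ m = cong suc (ℕₚ.n≡⌊n+n/2⌋ m)

1+m≡⌈2+m+m/2⌉ : ∀ m → suc m ≡ ⌈ suc (suc (m ℕ.+ m)) /2⌉
1+m≡⌈2+m+m/2⌉ m = cong suc (ℕₚ.n≡⌈n+n/2⌉ m)

i≡+n⇒+∣i∣≡i : ∀ {i n} → i ≡ + n → + ∣ i ∣ ≡ i
i≡+n⇒+∣i∣≡i ≡.refl = ≡.refl

quadratic≡pos : ∀ k x b → + k ℤ.+ (+ x ℤ.* + b ℤ.+ + 4 ℤ.* (+ b ℤ.* + b))
                        ≡ + (k ℕ.+ (x ℕ.* b ℕ.+ 4 ℕ.* (b ℕ.* b)))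
quadratic≡pos k x b = cong₂ (λ u v → + k ℤ.+ (u ℤ.+ v)) (≡.sym (ℤₚ.pos-* x b))
  (≡.trans (cong (+ 4 ℤ.*_) (≡.sym (ℤₚ.pos-* b b))) (≡.sym (ℤₚ.pos-* 4 (b ℕ.* b))))

A-exp B-exp : ℤ → ℤ
A-exp j = + 4 ℤ.* j ℤ.* j ℤ.- j
B-exp j = + 4 ℤ.* j ℤ.* j ℤ.+ + 3 ℤ.* j

+∣A-exp∣ : ∀ j → + ∣ A-exp j ∣ ≡ A-exp j
+∣A-exp∣ (+ zero) = ≡.refl
+∣A-exp∣ (+ suc b) = i≡+n⇒+∣i∣≡i (≡.trans (positive (+ b)) (quadratic≡pos 3 7 b))
  where
  positive : ∀ B → + 4 ℤ.* (+ 1 ℤ.+ B) ℤ.* (+ 1 ℤ.+ B) ℤ.- (+ 1 ℤ.+ B)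
                 ≡ + 3 ℤ.+ (+ 7 ℤ.* B ℤ.+ + 4 ℤ.* (B ℤ.* B))
  positive = ℤ-Solver.solve-∀
+∣A-exp∣ -[1+ b ] = i≡+n⇒+∣i∣≡i (≡.trans (negative (+ b)) (quadratic≡pos 5 9 b))
  where
  negative : ∀ B → + 4 ℤ.* (ℤ.- (+ 1 ℤ.+ B)) ℤ.* (ℤ.- (+ 1 ℤ.+ B)) ℤ.- (ℤ.- (+ 1 ℤ.+ B))
                 ≡ + 5 ℤ.+ (+ 9 ℤ.* B ℤ.+ + 4 ℤ.* (B ℤ.* B))
  negative = ℤ-Solver.solve-∀

+∣B-exp∣ : ∀ j → + ∣ B-exp j ∣ ≡ B-exp j
+∣B-exp∣ (+ b) = i≡+n⇒+∣i∣≡i (≡.trans (nonnegative (+ b)) (quadratic≡pos 0 3 b))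
  where
  nonnegative : ∀ B → + 4 ℤ.* B ℤ.* B ℤ.+ + 3 ℤ.* B ≡ + 0 ℤ.+ (+ 3 ℤ.* B ℤ.+ + 4 ℤ.* (B ℤ.* B))
  nonnegative = ℤ-Solver.solve-∀
+∣B-exp∣ -[1+ b ] = i≡+n⇒+∣i∣≡i (≡.trans (negative (+ b)) (quadratic≡pos 1 5 b))
  where
  negative : ∀ B → + 4 ℤ.* (ℤ.- (+ 1 ℤ.+ B)) ℤ.* (ℤ.- (+ 1 ℤ.+ B)) ℤ.+ + 3 ℤ.* (ℤ.- (+ 1 ℤ.+ B))
                 ≡ + 1 ℤ.+ (+ 5 ℤ.* B ℤ.+ + 4 ℤ.* (B ℤ.* B))
  negative = ℤ-Solver.solve-∀

abs-exponent : ∀ c {x y z} → + ∣ x ∣ ≡ x → + ∣ y ∣ ≡ y →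
               + c ℤ.+ y ≡ x ℤ.+ z → + (c ℕ.+ ∣ y ∣) ≡ + ∣ x ∣ ℤ.+ z
abs-exponent c {z = z} ∣x∣≡x ∣y∣≡y e =
  ≡.trans (cong (λ w → + c ℤ.+ w) ∣y∣≡y) (≡.trans e (cong (ℤ._+ z) (≡.sym ∣x∣≡x)))

module _ {r ℓ : Level} (R : CommutativeRing r ℓ) where
  open CommutativeRing R hiding (zero)
  open import Relation.Binary.Reasoning.Setoid setoid
  open Solver commutativeSemiring using (solve; _:=_; _:+_; _:*_; con)
  open GroupProperties +-group using (x≈y⇒x∙y⁻¹≈ε)
  open AbelianGroupProperties +-abelianGroup using (⁻¹-∙-comm)
  open RingProperties ring using ([y-z]x≈yx-zx)

  infixr 8 _^_
  _^_ : Carrier → ℕ → Carrier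
  _^_ = pow R

  G : Carrier → ℕ → ℕ → Carrier
  G = gauss R

  Σ< : ℕ → (ℕ → Carrier) → Carrier
  Σ< = sumTo R

  ^-distribˡ-+-* : ∀ x m n → x ^ (m ℕ.+ n) ≈ x ^ m * x ^ n
  ^-distribˡ-+-* x zero n = sym (*-identityˡ _)
  ^-distribˡ-+-* x (suc m) n = trans (*-congˡ (^-distribˡ-+-* x m n)) (sym (*-assoc _ _ _))

  square-^ : ∀ x n → (x * x) ^ n ≈ x ^ (n ℕ.+ n)
  square-^ x zero = refl
  square-^ x (suc n) = begin
    x * x * (x * x) ^ n    ≈⟨ *-congˡ (square-^ x n) ⟩
    x * x * x ^ (n ℕ.+ n)  ≈⟨ *-assoc _ _ _ ⟩
    x * x ^ (suc n ℕ.+ n)  ≡⟨ cong (λ k → x * x ^ k) (≡.sym (ℕₚ.+-suc n n)) ⟩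
    x ^ (suc n ℕ.+ suc n)  ∎

  Σ<-cong : ∀ N {f g} → (∀ i → f i ≈ g i) → Σ< N f ≈ Σ< N g
  Σ<-cong zero f≈g = refl
  Σ<-cong (suc N) f≈g = +-cong (Σ<-cong N f≈g) (f≈g N)

  Σ<-linear : ∀ N {f g h} c → (∀ i → f i ≈ g i + c * h i) → Σ< N f ≈ Σ< N g + c * Σ< N h
  Σ<-linear zero c f≈ = sym (trans (+-identityˡ _) (zeroʳ c))
  Σ<-linear (suc N) {f} {g} {h} c f≈ = begin
    Σ< N f + f N                             ≈⟨ +-cong (Σ<-linear N c f≈) (f≈ N) ⟩
    (Σ< N g + c * Σ< N h) + (g N + c * h N)  ≈⟨ solve 5 (λ c a b x y → (a :+ c :* b) :+ (x :+ c :* y)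
                                                                 := (a :+ x) :+ c :* (b :+ y))
                                                        refl c (Σ< N g) (Σ< N h) (g N) (h N) ⟩
    (Σ< N g + g N) + c * (Σ< N h + h N)      ∎

  Σ<-split-first : ∀ N f → Σ< (suc N) f ≈ f 0 + Σ< N (λ i → f (suc i))
  Σ<-split-first zero f = +-comm _ _
  Σ<-split-first (suc N) f = trans (+-congʳ (Σ<-split-first N f)) (+-assoc _ _ _)

  Σ<-drop-last : ∀ N f → f N ≈ 0# → Σ< (suc N) f ≈ Σ< N f
  Σ<-drop-last N f fN≈0 = trans (+-congˡ fN≈0) (+-identityʳ _)

  gauss-n-0 : ∀ p n → G p n 0 ≈ 1#
  gauss-n-0 p zero = refl
  gauss-n-0 p (suc n) = refl

  gauss-vanishes : ∀ p {n k} → n < k → G p n k ≈ 0#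
  gauss-vanishes p {zero} {suc k} _ = refl
  gauss-vanishes p {suc n} {suc k} (s≤s n<k) = begin
    G p n k + p ^ suc k * G p n (suc k)  ≈⟨ +-cong (gauss-vanishes p n<k)
                                                   (*-congˡ (gauss-vanishes p (ℕₚ.m≤n⇒m≤1+n n<k))) ⟩
    0# + p ^ suc k * 0#                  ≈⟨ trans (+-identityˡ _) (zeroʳ _) ⟩
    0#                                   ∎

  -- The second q-Pascal rule at (n, k), where d = n - k.
  Pascalʳ : Carrier → ℕ → ℕ → ℕ → Set ℓ
  Pascalʳ p d n k = G p (suc n) (suc k) ≈ p ^ d * G p n k + G p n (suc k)

  pascalʳ-diagonal : ∀ p k → Pascalʳ p 0 k k
  pascalʳ-diagonal p k = begin
    G p k k + p ^ suc k * G p k (suc k)  ≈⟨ +-congˡ (*-congˡ [k,1+k]≈0) ⟩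
    G p k k + p ^ suc k * 0#             ≈⟨ solve 2 (λ x y → x :+ y :* con 0 := con 1 :* x :+ con 0)
                                                    refl (G p k k) (p ^ suc k) ⟩
    1# * G p k k + 0#                    ≈⟨ +-congˡ (sym [k,1+k]≈0) ⟩
    1# * G p k k + G p k (suc k)         ∎
    where [k,1+k]≈0 = gauss-vanishes p (ℕₚ.n<1+n k)

  pascalʳ-step₀ : ∀ p d n → Pascalʳ p d n 0 → Pascalʳ p (suc d) (suc n) 0
  pascalʳ-step₀ p d n ih = begin
    1# + p ^ 1 * G p (suc n) 1                    ≈⟨ +-congˡ (*-congˡ (trans ih (+-congʳ (*-congˡ (gauss-n-0 p n))))) ⟩
    1# + p ^ 1 * (p ^ d * 1# + G p n 1)           ≈⟨ solve 3 (λ p x y → con 1 :+ p :* con 1 :* (x :* con 1 :+ y)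
                                                                   := p :* x :* con 1 :+ (con 1 :+ p :* con 1 :* y))
                                                             refl p (p ^ d) (G p n 1) ⟩
    p ^ suc d * 1# + (1# + p ^ 1 * G p n 1)       ≈⟨ +-congˡ (+-congʳ (sym (gauss-n-0 p n))) ⟩
    p ^ suc d * 1# + (G p n 0 + p ^ 1 * G p n 1)  ∎

  pascalʳ-step : ∀ p d n k → Pascalʳ p (suc d) n k → Pascalʳ p d n (suc k) →
                 Pascalʳ p (suc d) (suc n) (suc k)
  pascalʳ-step p d n k ih₁ ih₂ = begin
    G p (suc n) (suc k) + p ^ suc (suc k) * G p (suc n) (suc (suc k))  ≈⟨ +-cong ih₁ (*-congˡ ih₂) ⟩
    (p ^ suc d * a + b) + p ^ suc (suc k) * (p ^ d * b + c)
      ≈⟨ solve 6 (λ p x y a b c → (p :* x :* a :+ b) :+ p :* (p :* y) :* (x :* b :+ c)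
                                := p :* x :* (a :+ p :* y :* b) :+ (b :+ p :* (p :* y) :* c))
                 refl p (p ^ d) (p ^ k) a b c ⟩
    p ^ suc d * (a + p ^ suc k * b) + (b + p ^ suc (suc k) * c)        ∎
    where
    a = G p n k
    b = G p n (suc k)
    c = G p n (suc (suc k))

  gauss-pascalʳ : ∀ p d k → Pascalʳ p d (d ℕ.+ k) k
  gauss-pascalʳ p zero k = pascalʳ-diagonal p k
  gauss-pascalʳ p (suc d) zero = pascalʳ-step₀ p d (d ℕ.+ 0) (gauss-pascalʳ p d 0)
  gauss-pascalʳ p (suc d) (suc k) = pascalʳ-step p d (d ℕ.+ suc k) k
    (≡.subst (λ n → Pascalʳ p (suc d) n k) (≡.sym (ℕₚ.+-suc d k)) (gauss-pascalʳ p (suc d) k))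
    (gauss-pascalʳ p d (suc k))

  gauss-pascalʳ-weighted : ∀ p {n k} w w′ → (∀ d → d ℕ.+ k ≡ n → w * p ^ d ≈ w′) →
                           w * G p (suc n) (suc k) ≈ w′ * G p n k + w * G p n (suc k)
  gauss-pascalʳ-weighted p {n} {k} w w′ weight with k ℕ.≤? n
  ... | yes k≤n = begin
    w * G p (suc n) (suc k)                    ≈⟨ *-congˡ pascal ⟩
    w * (p ^ d * G p n k + G p n (suc k))      ≈⟨ distribˡ _ _ _ ⟩
    w * (p ^ d * G p n k) + w * G p n (suc k)  ≈⟨ +-congʳ (trans (sym (*-assoc _ _ _)) (*-congʳ (weight d d+k≡n))) ⟩
    w′ * G p n k + w * G p n (suc k)           ∎
    where
    d = n ℕ.∸ k
    d+k≡n = ℕₚ.m∸n+n≡m k≤n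
    pascal = ≡.subst (λ m → Pascalʳ p d m k) d+k≡n (gauss-pascalʳ p d k)
  ... | no k≰n = begin
    w * G p (suc n) (suc k)           ≈⟨ *-congˡ (gauss-vanishes p (s≤s n<k)) ⟩
    w * 0#                            ≈⟨ solve 2 (λ w w′ → w :* con 0 := w′ :* con 0 :+ w :* con 0) refl w w′ ⟩
    w′ * 0# + w * 0#                  ≈⟨ sym (+-cong (*-congˡ (gauss-vanishes p n<k))
                                                     (*-congˡ (gauss-vanishes p (ℕₚ.m≤n⇒m≤1+n n<k)))) ⟩
    w′ * G p n k + w * G p n (suc k)  ∎
    where n<k = ℕₚ.≰⇒> k≰n

  gauss-pascalʳ-scaled : ∀ p n k → p ^ k * G p (suc n) (suc k) ≈ p ^ n * G p n k + p ^ k * G p n (suc k)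
  gauss-pascalʳ-scaled p n k = gauss-pascalʳ-weighted p {n} {k} (p ^ k) (p ^ n) λ d d+k≡n →
    trans (sym (^-distribˡ-+-* p k d)) (reflexive (cong (p ^_) (≡.trans (ℕₚ.+-comm k d) d+k≡n)))

  coupled-recurrence : ∀ q (e o : ℕ → Carrier) →
    (∀ n → e (suc n) ≈ e n + q ^ suc n * o n) →
    (∀ n → o (suc n) ≈ o n + q ^ n * e n) →
    ∀ n → e (suc (suc n)) - (1# + q) * e (suc n) + (q - q ^ (2 ℕ.* n ℕ.+ 2)) * e n ≈ 0#
  coupled-recurrence q e o e-suc o-suc n = begin
    e₂ - (1# + q) * e₁ + (q - Q) * e₀         ≈⟨ +-congˡ ([y-z]x≈yx-zx e₀ q Q) ⟩
    e₂ - (1# + q) * e₁ + (q * e₀ - Q * e₀)    ≈⟨ interchange e₂ ((1# + q) * e₁) (q * e₀) (Q * e₀) ⟩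
    (e₂ + q * e₀) - ((1# + q) * e₁ + Q * e₀)  ≈⟨ x≈y⇒x∙y⁻¹≈ε key ⟩
    0#                                        ∎
    where
    e₀ = e n
    e₁ = e (suc n)
    e₂ = e (suc (suc n))
    P = q ^ n
    Q = q ^ (2 ℕ.* n ℕ.+ 2)

    interchange : ∀ a b c d → a - b + (c - d) ≈ (a + c) - (b + d)
    interchange a b c d = trans
      (solve 4 (λ a b c d → (a :+ b) :+ (c :+ d) := (a :+ c) :+ (b :+ d)) refl a (- b) c (- d))
      (+-congˡ (⁻¹-∙-comm b d))

    Q≈qqPP : Q ≈ q * (q * (P * P))
    Q≈qqPP = begin
      q ^ (2 ℕ.* n ℕ.+ 2)      ≡⟨ cong (q ^_) (≡.trans (ℕₚ.+-comm (2 ℕ.* n) 2)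
                                                       (cong (λ m → suc (suc (n ℕ.+ m))) (ℕₚ.+-identityʳ n))) ⟩
      q * (q * q ^ (n ℕ.+ n))  ≈⟨ *-congˡ (*-congˡ (^-distribˡ-+-* q n n)) ⟩
      q * (q * (P * P))        ∎

    key : e₂ + q * e₀ ≈ (1# + q) * e₁ + Q * e₀
    key = begin
      e₂ + q * e₀
        ≈⟨ +-congʳ (trans (e-suc (suc n)) (+-congˡ (*-congˡ (o-suc n)))) ⟩
      e₁ + q * (q * P) * (o n + P * e₀) + q * e₀
        ≈⟨ solve 5 (λ q P e₀ e₁ o → e₁ :+ q :* (q :* P) :* (o :+ P :* e₀) :+ q :* e₀
                                 := e₁ :+ q :* (e₀ :+ q :* P :* o) :+ q :* (q :* (P :* P)) :* e₀)
                   refl q P e₀ e₁ (o n) ⟩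
      e₁ + q * (e₀ + q * P * o n) + q * (q * (P * P)) * e₀
        ≈⟨ +-cong (+-congˡ (*-congˡ (sym (e-suc n)))) (*-congʳ (sym Q≈qqPP)) ⟩
      e₁ + q * e₁ + Q * e₀
        ≈⟨ +-congʳ (solve 2 (λ q e → e :+ q :* e := (con 1 :+ q) :* e) refl q e₁) ⟩
      (1# + q) * e₁ + Q * e₀
        ∎

  module _ (q : Carrier) where

    even-term odd-term : ℕ → ℕ → Carrier
    even-term n j = q ^ (2 ℕ.* j ℕ.* j) * G q n (2 ℕ.* j)
    odd-term n j = q ^ (2 ℕ.* j ℕ.* j ℕ.+ 2 ℕ.* j) * G q n (suc (2 ℕ.* j))

    S-odd : ℕ → Carrier
    S-odd n = Σ< (suc n) (odd-term n)

    even-term-vanishes : ∀ n → even-term n (suc n) ≈ 0#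
    even-term-vanishes n = trans (*-congˡ (gauss-vanishes q (ℕₚ.m≤m+n (suc n) _))) (zeroʳ _)

    odd-term-vanishes : ∀ n → odd-term n (suc n) ≈ 0#
    odd-term-vanishes n = trans (*-congˡ (gauss-vanishes q (ℕₚ.m≤n⇒m≤1+n (ℕₚ.m≤m+n (suc n) _)))) (zeroʳ _)

    gauss-pascalʳ-split : ∀ a n b → q ^ (a ℕ.+ b) * G q (suc n) (suc b)
                                  ≈ q ^ (a ℕ.+ b) * G q n (suc b) + q ^ n * (q ^ a * G q n b)
    gauss-pascalʳ-split a n b = begin
      q ^ (a ℕ.+ b) * G q (suc n) (suc b)
        ≈⟨ trans (*-congʳ (^-distribˡ-+-* q a b)) (*-assoc _ _ _) ⟩
      q ^ a * (q ^ b * G q (suc n) (suc b))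
        ≈⟨ *-congˡ (gauss-pascalʳ-scaled q n b) ⟩
      q ^ a * (q ^ n * G q n b + q ^ b * G q n (suc b))
        ≈⟨ solve 5 (λ x y z u v → x :* (z :* u :+ y :* v) := x :* y :* v :+ z :* (x :* u))
                   refl (q ^ a) (q ^ b) (q ^ n) (G q n b) (G q n (suc b)) ⟩
      q ^ a * q ^ b * G q n (suc b) + q ^ n * (q ^ a * G q n b)
        ≈⟨ +-congʳ (*-congʳ (sym (^-distribˡ-+-* q a b))) ⟩
      q ^ (a ℕ.+ b) * G q n (suc b) + q ^ n * (q ^ a * G q n b)
        ∎

    odd-term-suc : ∀ n j → odd-term (suc n) j ≈ odd-term n j + q ^ n * even-term n j
    odd-term-suc n j = gauss-pascalʳ-split (2 ℕ.* j ℕ.* j) n (2 ℕ.* j)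

    even-term-suc : ∀ n j → even-term (suc n) (suc j) ≈ even-term n (suc j) + q ^ suc n * odd-term n j
    even-term-suc n j = begin
      even-term (suc n) (suc j)
        ≡⟨ cong₂ (λ e i → q ^ e * G q (suc n) i) (exponent j) (index j) ⟩
      q ^ (suc a ℕ.+ suc b) * G q (suc n) (suc (suc b))
        ≈⟨ gauss-pascalʳ-split (suc a) n (suc b) ⟩
      q ^ (suc a ℕ.+ suc b) * G q n (suc (suc b)) + q ^ n * (q * q ^ a * G q n (suc b))
        ≈⟨ +-cong (reflexive (cong₂ (λ e i → q ^ e * G q n i) (≡.sym (exponent j)) (≡.sym (index j))))
                  (solve 4 (λ q x y g → y :* (q :* x :* g) := q :* y :* (x :* g)) refl q (q ^ a) (q ^ n) (G q n (suc b))) ⟩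
      even-term n (suc j) + q ^ suc n * odd-term n j
        ∎
      where
      a = 2 ℕ.* j ℕ.* j ℕ.+ 2 ℕ.* j
      b = 2 ℕ.* j
      exponent : ∀ j → 2 ℕ.* suc j ℕ.* suc j ≡ suc (2 ℕ.* j ℕ.* j ℕ.+ 2 ℕ.* j) ℕ.+ suc (2 ℕ.* j)
      exponent = ℕ-Solver.solve-∀
      index : ∀ j → 2 ℕ.* suc j ≡ suc (suc (2 ℕ.* j))
      index = ℕ-Solver.solve-∀

    S-suc : ∀ n → S R q (suc n) ≈ S R q n + q ^ suc n * S-odd n
    S-suc n = begin
      S R q (suc n)
        ≈⟨ Σ<-split-first (suc n) (even-term (suc n)) ⟩
      even-term (suc n) 0 + Σ< (suc n) (λ j → even-term (suc n) (suc j))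
        ≈⟨ +-cong (*-congˡ (sym (gauss-n-0 q n))) (Σ<-linear (suc n) (q ^ suc n) (even-term-suc n)) ⟩
      even-term n 0 + (Σ< (suc n) (λ j → even-term n (suc j)) + q ^ suc n * S-odd n)
        ≈⟨ sym (+-assoc _ _ _) ⟩
      (even-term n 0 + Σ< (suc n) (λ j → even-term n (suc j))) + q ^ suc n * S-odd n
        ≈⟨ +-congʳ (sym (Σ<-split-first (suc n) (even-term n))) ⟩
      Σ< (suc (suc n)) (even-term n) + q ^ suc n * S-odd n
        ≈⟨ +-congʳ (Σ<-drop-last (suc n) (even-term n) (even-term-vanishes n)) ⟩
      S R q n + q ^ suc n * S-odd n
        ∎

    S-odd-suc : ∀ n → S-odd (suc n) ≈ S-odd n + q ^ n * S R q n
    S-odd-suc n = begin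
      S-odd (suc n)
        ≈⟨ Σ<-linear (suc (suc n)) (q ^ n) (odd-term-suc n) ⟩
      Σ< (suc (suc n)) (odd-term n) + q ^ n * Σ< (suc (suc n)) (even-term n)
        ≈⟨ +-cong (Σ<-drop-last (suc n) (odd-term n) (odd-term-vanishes n))
                  (*-congˡ (Σ<-drop-last (suc n) (even-term n) (even-term-vanishes n))) ⟩
      S-odd n + q ^ n * S R q n
        ∎

  Σ± : ℕ → (ℤ → Carrier) → Carrier
  Σ± zero f = f (+ 0)
  Σ± (suc M) f = f -[1+ M ] + Σ± M f + f (+ suc M)

  Σ±-linear : ∀ M {f g h} c → (∀ j → f j ≈ g j + c * h j) → Σ± M f ≈ Σ± M g + c * Σ± M h
  Σ±-linear zero c f≈ = f≈ (+ 0)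
  Σ±-linear (suc M) {f} {g} {h} c f≈ = begin
    f -[1+ M ] + Σ± M f + f (+ suc M)
      ≈⟨ +-cong (+-cong (f≈ -[1+ M ]) (Σ±-linear M c f≈)) (f≈ (+ suc M)) ⟩
    (g -[1+ M ] + c * h -[1+ M ]) + (Σ± M g + c * Σ± M h) + (g (+ suc M) + c * h (+ suc M))
      ≈⟨ solve 7 (λ c a b x y u v → (a :+ c :* b) :+ (x :+ c :* y) :+ (u :+ c :* v)
                                  := (a :+ x :+ u) :+ c :* (b :+ y :+ v))
                 refl c (g -[1+ M ]) (h -[1+ M ]) (Σ± M g) (Σ± M h) (g (+ suc M)) (h (+ suc M)) ⟩
    Σ± (suc M) g + c * Σ± (suc M) h
      ∎

  Σ±-drop-ends : ∀ M f → f -[1+ M ] ≈ 0# → f (+ suc M) ≈ 0# → Σ± (suc M) f ≈ Σ± M f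
  Σ±-drop-ends M f f₋≈0 f₊≈0 = begin
    f -[1+ M ] + Σ± M f + f (+ suc M)  ≈⟨ +-cong (+-congʳ f₋≈0) f₊≈0 ⟩
    0# + Σ± M f + 0#                   ≈⟨ trans (+-identityʳ _) (+-identityˡ _) ⟩
    Σ± M f                             ∎

  Σ±-shift : ∀ M f g → (∀ j → g j ≈ f (j ℤ.+ + 1)) → Σ± M g + f (ℤ.- + M) ≈ Σ± M f + f (+ suc M)
  Σ±-shift zero f g g≈ = trans (+-congʳ (g≈ (+ 0))) (+-comm _ _)
  Σ±-shift (suc M) f g g≈ = begin
    g -[1+ M ] + Σ± M g + g (+ suc M) + f -[1+ M ]
      ≈⟨ +-congʳ (+-cong (+-congʳ (trans (g≈ _) (reflexive (cong f (-[1+M]+1≡-M M)))))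
                         (trans (g≈ _) (reflexive (cong (λ k → f (+ suc k)) (ℕₚ.+-comm M 1))))) ⟩
    f (ℤ.- + M) + Σ± M g + f (+ suc (suc M)) + f -[1+ M ]
      ≈⟨ solve 4 (λ a x c d → a :+ x :+ c :+ d := (x :+ a) :+ c :+ d)
                 refl (f (ℤ.- + M)) (Σ± M g) (f (+ suc (suc M))) (f -[1+ M ]) ⟩
    (Σ± M g + f (ℤ.- + M)) + f (+ suc (suc M)) + f -[1+ M ]
      ≈⟨ +-congʳ (+-congʳ (Σ±-shift M f g g≈)) ⟩
    (Σ± M f + f (+ suc M)) + f (+ suc (suc M)) + f -[1+ M ]
      ≈⟨ solve 4 (λ y b c d → (y :+ b) :+ c :+ d := d :+ y :+ b :+ c)
                 refl (Σ± M f) (f (+ suc M)) (f (+ suc (suc M))) (f -[1+ M ]) ⟩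
    f -[1+ M ] + Σ± M f + f (+ suc M) + f (+ suc (suc M))
      ∎
    where
    -[1+M]+1≡-M : ∀ M → -[1+ M ] ℤ.+ + 1 ≡ ℤ.- + M
    -[1+M]+1≡-M zero = ≡.refl
    -[1+M]+1≡-M (suc M) = ≡.refl

  Σ±-shift-vanishing : ∀ M f g → (∀ j → g j ≈ f (j ℤ.+ + 1)) →
                       f (ℤ.- + M) ≈ 0# → f (+ suc M) ≈ 0# → Σ± M g ≈ Σ± M f
  Σ±-shift-vanishing M f g g≈ f₋≈0 f₊≈0 = begin
    Σ± M g                ≈⟨ sym (trans (+-congˡ f₋≈0) (+-identityʳ _)) ⟩
    Σ± M g + f (ℤ.- + M)  ≈⟨ Σ±-shift M f g g≈ ⟩
    Σ± M f + f (+ suc M)  ≈⟨ trans (+-congˡ f₊≈0) (+-identityʳ _) ⟩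
    Σ± M f                ∎

  Σ<-as-Σ± : ∀ M f → Σ< (suc (2 ℕ.* M)) (λ i → f (jOf R M i)) ≈ Σ± M f
  Σ<-as-Σ± zero f = +-identityˡ _
  Σ<-as-Σ± (suc M) f = begin
    Σ< (suc (2 ℕ.* suc M)) g
      ≡⟨ cong (λ k → Σ< (suc k) g) (two-suc M) ⟩
    Σ< (suc (suc (2 ℕ.* M))) g + g (suc (suc (2 ℕ.* M)))
      ≈⟨ +-cong (Σ<-split-first (suc (2 ℕ.* M)) g) (reflexive (cong f last-index)) ⟩
    g 0 + Σ< (suc (2 ℕ.* M)) (λ i → g (suc i)) + f (+ suc M)
      ≈⟨ +-congʳ (+-congˡ (trans (Σ<-cong (suc (2 ℕ.* M)) (λ i → reflexive (cong f (jOf-suc i))))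
                                 (Σ<-as-Σ± M f))) ⟩
    f -[1+ M ] + Σ± M f + f (+ suc M)
      ∎
    where
    g : ℕ → Carrier
    g i = f (jOf R (suc M) i)
    two-suc : ∀ M → 2 ℕ.* suc M ≡ suc (suc (2 ℕ.* M))
    two-suc = ℕ-Solver.solve-∀
    two-suc′ : ∀ M → suc (suc (2 ℕ.* M)) ≡ suc M ℕ.+ suc M
    two-suc′ = ℕ-Solver.solve-∀
    x+x-x≡x : ∀ x → x ℤ.+ x ℤ.- x ≡ x
    x+x-x≡x = ℤ-Solver.solve-∀
    jOf-suc : ∀ i → jOf R (suc M) (suc i) ≡ jOf R M i
    jOf-suc i = ≡.trans (ℤₚ.[1+m]⊖[1+n]≡m⊖n i M) (≡.sym (ℤₚ.m-n≡m⊖n i M))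
    last-index : jOf R (suc M) (suc (suc (2 ℕ.* M))) ≡ + suc M
    last-index = ≡.trans (cong (λ k → + k ℤ.- + suc M) (two-suc′ M)) (x+x-x≡x (+ suc M))

  gaussℤ-⊖ : ∀ p N {x y} → x < y → gaussℤ R p N (x ℤ.⊖ y) ≈ 0#
  gaussℤ-⊖ p N {zero} {suc y} _ = refl
  gaussℤ-⊖ p N {suc x} {suc y} (s≤s x<y) =
    trans (reflexive (cong (gaussℤ R p N) (ℤₚ.[1+m]⊖[1+n]≡m⊖n x y))) (gaussℤ-⊖ p N x<y)

  module _ (q : Carrier) where

    qterm : ℤ → ℕ → ℤ → Carrier
    qterm e N K = q ^ ∣ e ∣ * gaussℤ R (q * q) N K

    weight-split : ∀ a c d x → c ℕ.+ d ≡ a ℕ.+ (x ℕ.+ x) → q ^ a * (q * q) ^ x ≈ q ^ c * q ^ d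
    weight-split a c d x e = begin
      q ^ a * (q * q) ^ x    ≈⟨ *-congˡ (square-^ q x) ⟩
      q ^ a * q ^ (x ℕ.+ x)  ≈⟨ sym (^-distribˡ-+-* q a (x ℕ.+ x)) ⟩
      q ^ (a ℕ.+ (x ℕ.+ x))  ≡⟨ cong (q ^_) (≡.sym e) ⟩
      q ^ (c ℕ.+ d)          ≈⟨ ^-distribˡ-+-* q c d ⟩
      q ^ c * q ^ d          ∎

    -- The index and exponent side conditions are hypotheses so that each use
    -- is discharged by integer ring identities.
    qterm-pascal : ∀ N c K {x y L L′} → + ∣ x ∣ ≡ x → + ∣ y ∣ ≡ y →
                   L ≡ + 1 ℤ.+ K → L′ ≡ + 1 ℤ.+ K → + c ℤ.+ y ≡ x ℤ.+ + 2 ℤ.* L →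
                   qterm x (suc N) L ≈ qterm x N K + q ^ c * qterm y N L′
    qterm-pascal N c K {x} {y} ∣x∣≡x ∣y∣≡y ≡.refl ≡.refl e = pascal K (abs-exponent c ∣x∣≡x ∣y∣≡y e)
      where
      a = ∣ x ∣
      d = ∣ y ∣
      pascal : ∀ K → + (c ℕ.+ d) ≡ + a ℤ.+ + 2 ℤ.* (+ 1 ℤ.+ K) →
               qterm x (suc N) (+ 1 ℤ.+ K) ≈ qterm x N K + q ^ c * qterm y N (+ 1 ℤ.+ K)
      pascal (+ k) e = begin
        q ^ a * (G p N k + p ^ suc k * G p N (suc k))          ≈⟨ distribˡ _ _ _ ⟩
        q ^ a * G p N k + q ^ a * (p ^ suc k * G p N (suc k))  ≈⟨ +-congˡ (trans (sym (*-assoc _ _ _))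
                                                                   (trans (*-congʳ (weight-split a c d (suc k) c+d≡a+2k))
                                                                          (*-assoc _ _ _))) ⟩
        q ^ a * G p N k + q ^ c * (q ^ d * G p N (suc k))      ∎
        where
        p = q * q
        c+d≡a+2k = ≡.trans (ℤₚ.+-injective e) (cong (λ z → a ℕ.+ (suc k ℕ.+ z)) (ℕₚ.+-identityʳ (suc k)))
      pascal -[1+ 0 ] e = begin
        q ^ a * 1#                                ≈⟨ weight-split a c d 0 (ℤₚ.+-injective e) ⟩
        q ^ c * q ^ d                             ≈⟨ solve 3 (λ x y z → y :* z := x :* con 0 :+ y :* (z :* con 1))
                                                               refl (q ^ a) (q ^ c) (q ^ d) ⟩
        q ^ a * 0# + q ^ c * (q ^ d * 1#)         ≈⟨ +-congˡ (*-congˡ (*-congˡ (sym (gauss-n-0 (q * q) N)))) ⟩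
        qterm x N -[1+ 0 ] + q ^ c * qterm y N (+ 0)  ∎
      pascal -[1+ suc b ] e =
        solve 3 (λ x y z → x :* con 0 := x :* con 0 :+ y :* (z :* con 0)) refl (q ^ a) (q ^ c) (q ^ d)

    qterm-pascalʳ : ∀ N c K {x y L} → + ∣ x ∣ ≡ x → + ∣ y ∣ ≡ y →
                    L ≡ + 1 ℤ.+ K → + c ℤ.+ y ≡ x ℤ.+ + 2 ℤ.* (+ N ℤ.- K) →
                    qterm x (suc N) L ≈ qterm x N L + q ^ c * qterm y N K
    qterm-pascalʳ N c K {x} {y} ∣x∣≡x ∣y∣≡y ≡.refl e = pascalʳ K (abs-exponent c ∣x∣≡x ∣y∣≡y e)
      where
      a = ∣ x ∣
      d = ∣ y ∣
      pascalʳ : ∀ K → + (c ℕ.+ d) ≡ + a ℤ.+ + 2 ℤ.* (+ N ℤ.- K) →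
                qterm x (suc N) (+ 1 ℤ.+ K) ≈ qterm x N (+ 1 ℤ.+ K) + q ^ c * qterm y N K
      pascalʳ (+ k) e = begin
        q ^ a * G p (suc N) (suc k)                        ≈⟨ gauss-pascalʳ-weighted p (q ^ a) (q ^ c * q ^ d) weight ⟩
        q ^ c * q ^ d * G p N k + q ^ a * G p N (suc k)    ≈⟨ trans (+-comm _ _) (+-congˡ (*-assoc _ _ _)) ⟩
        q ^ a * G p N (suc k) + q ^ c * (q ^ d * G p N k)  ∎
        where
        p = q * q
        twice-difference : ∀ D K → + 2 ℤ.* ((D ℤ.+ K) ℤ.- K) ≡ D ℤ.+ D
        twice-difference = ℤ-Solver.solve-∀
        weight : ∀ z → z ℕ.+ k ≡ N → q ^ a * p ^ z ≈ q ^ c * q ^ d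
        weight z z+k≡N = weight-split a c d z (ℤₚ.+-injective (≡.trans e (≡.trans
          (cong (λ n → + a ℤ.+ + 2 ℤ.* (+ n ℤ.- + k)) (≡.sym z+k≡N))
          (cong (λ w → + a ℤ.+ w) (twice-difference (+ z) (+ k))))))
      pascalʳ -[1+ 0 ] e = begin
        q ^ a * 1#                                    ≈⟨ solve 3 (λ x y z → x :* con 1 := x :* con 1 :+ y :* (z :* con 0))
                                                                   refl (q ^ a) (q ^ c) (q ^ d) ⟩
        q ^ a * 1# + q ^ c * (q ^ d * 0#)             ≈⟨ +-congʳ (*-congˡ (sym (gauss-n-0 (q * q) N))) ⟩
        qterm x N (+ 0) + q ^ c * qterm y N -[1+ 0 ]  ∎
      pascalʳ -[1+ suc b ] e =
        solve 3 (λ x y z → x :* con 0 := x :* con 0 :+ y :* (z :* con 0)) refl (q ^ a) (q ^ c) (q ^ d)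

    A-term B-term : ℕ → ℕ → ℤ → Carrier
    A-term N μ j = qterm (A-exp j) N (+ μ ℤ.- + 2 ℤ.* j)
    B-term N μ j = qterm (B-exp j) N (+ μ ℤ.- + 2 ℤ.* j ℤ.- + 1)

    A-vanishes : ∀ {N μ} j → μ ≤ N → N < ∣ j ∣ → A-term N μ j ≈ 0#
    A-vanishes {N} {μ} (+ suc a) μ≤N (s≤s N≤a) = trans (*-congˡ (trans
      (reflexive (cong (gaussℤ R (q * q) N) (index (+ μ) (+ a))))
      (gaussℤ-⊖ (q * q) N (s≤s (ℕₚ.m≤n⇒m≤1+n
                                 (ℕₚ.≤-trans μ≤N (ℕₚ.≤-trans N≤a (ℕₚ.m≤m+n a a))))))))
      (zeroʳ _)
      where
      index : ∀ M A → M ℤ.- + 2 ℤ.* (+ 1 ℤ.+ A) ≡ M ℤ.- (+ 2 ℤ.+ (A ℤ.+ A))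
      index = ℤ-Solver.solve-∀
    A-vanishes {N} {μ} -[1+ a ] μ≤N (s≤s N≤a) = trans (*-congˡ (trans
      (reflexive (cong (gaussℤ R (q * q) N) (index (+ μ) (+ a))))
      (gauss-vanishes (q * q) (ℕₚ.≤-trans (s≤s (ℕₚ.≤-trans N≤a (ℕₚ.m≤m+n a a)))
                                          (ℕₚ.≤-trans (ℕₚ.n≤1+n _) (ℕₚ.m≤n+m _ μ))))))
      (zeroʳ _)
      where
      index : ∀ M A → M ℤ.- + 2 ℤ.* (ℤ.- (+ 1 ℤ.+ A)) ≡ M ℤ.+ (+ 2 ℤ.+ (A ℤ.+ A))
      index = ℤ-Solver.solve-∀

    B-vanishes : ∀ {N μ} j → μ ≤ N → N < ∣ j ∣ → B-term N μ j ≈ 0#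
    B-vanishes {N} {μ} (+ suc a) μ≤N (s≤s N≤a) = trans (*-congˡ (trans
      (reflexive (cong (gaussℤ R (q * q) N) (index (+ μ) (+ a))))
      (gaussℤ-⊖ (q * q) N (s≤s (ℕₚ.m≤n⇒m≤1+n (ℕₚ.m≤n⇒m≤1+n
                                 (ℕₚ.≤-trans μ≤N (ℕₚ.≤-trans N≤a (ℕₚ.m≤m+n a a)))))))))
      (zeroʳ _)
      where
      index : ∀ M A → M ℤ.- + 2 ℤ.* (+ 1 ℤ.+ A) ℤ.- + 1 ≡ M ℤ.- (+ 3 ℤ.+ (A ℤ.+ A))
      index = ℤ-Solver.solve-∀
    B-vanishes {N} {μ} -[1+ a ] μ≤N (s≤s N≤a) = trans (*-congˡ (trans
      (reflexive (cong (gaussℤ R (q * q) N) (index (+ μ) (+ a))))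
      (gauss-vanishes (q * q) (ℕₚ.≤-trans (s≤s (ℕₚ.≤-trans N≤a (ℕₚ.m≤m+n a a))) (ℕₚ.m≤n+m _ μ)))))
      (zeroʳ _)
      where
      index : ∀ M A → M ℤ.- + 2 ℤ.* (ℤ.- (+ 1 ℤ.+ A)) ℤ.- + 1 ≡ M ℤ.+ (+ 1 ℤ.+ (A ℤ.+ A))
      index = ℤ-Solver.solve-∀

    A-term-suc-even : ∀ m j → A-term (suc (m ℕ.+ m)) (suc m) j
                            ≈ A-term (m ℕ.+ m) m j + q ^ suc (m ℕ.+ m) * B-term (m ℕ.+ m) m (j ℤ.- + 1)
    A-term-suc-even m j =
      qterm-pascal (m ℕ.+ m) (suc (m ℕ.+ m)) (+ m ℤ.- + 2 ℤ.* j) (+∣A-exp∣ j) (+∣B-exp∣ (j ℤ.- + 1))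
                   (index₁ (+ m) j) (index₂ (+ m) j) (exponent (+ m) j)
      where
      index₁ : ∀ M J → (+ 1 ℤ.+ M) ℤ.- + 2 ℤ.* J ≡ + 1 ℤ.+ (M ℤ.- + 2 ℤ.* J)
      index₁ = ℤ-Solver.solve-∀
      index₂ : ∀ M J → M ℤ.- + 2 ℤ.* (J ℤ.- + 1) ℤ.- + 1 ≡ + 1 ℤ.+ (M ℤ.- + 2 ℤ.* J)
      index₂ = ℤ-Solver.solve-∀
      exponent : ∀ M J → + 1 ℤ.+ (M ℤ.+ M) ℤ.+ (+ 4 ℤ.* (J ℤ.- + 1) ℤ.* (J ℤ.- + 1) ℤ.+ + 3 ℤ.* (J ℤ.- + 1))
                       ≡ (+ 4 ℤ.* J ℤ.* J ℤ.- J) ℤ.+ + 2 ℤ.* ((+ 1 ℤ.+ M) ℤ.- + 2 ℤ.* J)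
      exponent = ℤ-Solver.solve-∀

    B-term-suc-even : ∀ m j → B-term (suc (m ℕ.+ m)) (suc m) j
                            ≈ B-term (m ℕ.+ m) m j + q ^ (m ℕ.+ m) * A-term (m ℕ.+ m) m j
    B-term-suc-even m j =
      qterm-pascal (m ℕ.+ m) (m ℕ.+ m) (+ m ℤ.- + 2 ℤ.* j ℤ.- + 1) (+∣B-exp∣ j) (+∣A-exp∣ j)
                   (index₁ (+ m) j) (index₂ (+ m) j) (exponent (+ m) j)
      where
      index₁ : ∀ M J → (+ 1 ℤ.+ M) ℤ.- + 2 ℤ.* J ℤ.- + 1 ≡ + 1 ℤ.+ (M ℤ.- + 2 ℤ.* J ℤ.- + 1)
      index₁ = ℤ-Solver.solve-∀
      index₂ : ∀ M J → M ℤ.- + 2 ℤ.* J ≡ + 1 ℤ.+ (M ℤ.- + 2 ℤ.* J ℤ.- + 1)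
      index₂ = ℤ-Solver.solve-∀
      exponent : ∀ M J → (M ℤ.+ M) ℤ.+ (+ 4 ℤ.* J ℤ.* J ℤ.- J)
                       ≡ (+ 4 ℤ.* J ℤ.* J ℤ.+ + 3 ℤ.* J) ℤ.+ + 2 ℤ.* ((+ 1 ℤ.+ M) ℤ.- + 2 ℤ.* J ℤ.- + 1)
      exponent = ℤ-Solver.solve-∀

    A-term-suc-odd : ∀ m j → A-term (suc (suc (m ℕ.+ m))) (suc m) j
                           ≈ A-term (suc (m ℕ.+ m)) (suc m) j
                             + q ^ suc (suc (m ℕ.+ m)) * B-term (suc (m ℕ.+ m)) (suc m) j
    A-term-suc-odd m j =
      qterm-pascalʳ (suc (m ℕ.+ m)) (suc (suc (m ℕ.+ m))) (+ suc m ℤ.- + 2 ℤ.* j ℤ.- + 1)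
                    (+∣A-exp∣ j) (+∣B-exp∣ j) (index (+ suc m) j) (exponent (+ m) j)
      where
      index : ∀ M J → M ℤ.- + 2 ℤ.* J ≡ + 1 ℤ.+ (M ℤ.- + 2 ℤ.* J ℤ.- + 1)
      index = ℤ-Solver.solve-∀
      exponent : ∀ M J → + 2 ℤ.+ (M ℤ.+ M) ℤ.+ (+ 4 ℤ.* J ℤ.* J ℤ.+ + 3 ℤ.* J)
                       ≡ (+ 4 ℤ.* J ℤ.* J ℤ.- J)
                         ℤ.+ + 2 ℤ.* ((+ 1 ℤ.+ (M ℤ.+ M)) ℤ.- ((+ 1 ℤ.+ M) ℤ.- + 2 ℤ.* J ℤ.- + 1))
      exponent = ℤ-Solver.solve-∀

    B-term-suc-odd : ∀ m j → B-term (suc (suc (m ℕ.+ m))) (suc m) j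
                           ≈ B-term (suc (m ℕ.+ m)) (suc m) j
                             + q ^ suc (m ℕ.+ m) * A-term (suc (m ℕ.+ m)) (suc m) (j ℤ.+ + 1)
    B-term-suc-odd m j =
      qterm-pascalʳ (suc (m ℕ.+ m)) (suc (m ℕ.+ m)) (+ suc m ℤ.- + 2 ℤ.* (j ℤ.+ + 1))
                    (+∣B-exp∣ j) (+∣A-exp∣ (j ℤ.+ + 1)) (index (+ suc m) j) (exponent (+ m) j)
      where
      index : ∀ M J → M ℤ.- + 2 ℤ.* J ℤ.- + 1 ≡ + 1 ℤ.+ (M ℤ.- + 2 ℤ.* (J ℤ.+ + 1))
      index = ℤ-Solver.solve-∀
      exponent : ∀ M J → + 1 ℤ.+ (M ℤ.+ M) ℤ.+ (+ 4 ℤ.* (J ℤ.+ + 1) ℤ.* (J ℤ.+ + 1) ℤ.- (J ℤ.+ + 1))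
                       ≡ (+ 4 ℤ.* J ℤ.* J ℤ.+ + 3 ℤ.* J)
                         ℤ.+ + 2 ℤ.* ((+ 1 ℤ.+ (M ℤ.+ M)) ℤ.- ((+ 1 ℤ.+ M) ℤ.- + 2 ℤ.* (J ℤ.+ + 1)))
      exponent = ℤ-Solver.solve-∀

    ΣA ΣB : ℕ → ℕ → Carrier
    ΣA N μ = Σ± N (A-term N μ)
    ΣB N μ = Σ± N (B-term N μ)

    A-Step B-Step : ℕ → ℕ → ℕ → Set ℓ
    A-Step n μ μ′ = ΣA (suc n) μ′ ≈ ΣA n μ + q ^ suc n * ΣB n μ
    B-Step n μ μ′ = ΣB (suc n) μ′ ≈ ΣB n μ + q ^ n * ΣA n μ

    A-drop-ends : ∀ {N μ} → μ ≤ N → Σ± (suc N) (A-term N μ) ≈ ΣA N μ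
    A-drop-ends {N} μ≤N =
      Σ±-drop-ends N _ (A-vanishes -[1+ N ] μ≤N (ℕₚ.n<1+n N)) (A-vanishes (+ suc N) μ≤N (ℕₚ.n<1+n N))

    B-drop-ends : ∀ {N μ} → μ ≤ N → Σ± (suc N) (B-term N μ) ≈ ΣB N μ
    B-drop-ends {N} μ≤N =
      Σ±-drop-ends N _ (B-vanishes -[1+ N ] μ≤N (ℕₚ.n<1+n N)) (B-vanishes (+ suc N) μ≤N (ℕₚ.n<1+n N))

    ΣA-suc-even : ∀ m → A-Step (m ℕ.+ m) m (suc m)
    ΣA-suc-even m = trans (Σ±-linear (suc n) _ (A-term-suc-even m)) (+-cong (A-drop-ends μ≤n) (*-congˡ shifted))
      where
      n = m ℕ.+ m
      μ≤n = ℕₚ.m≤m+n m m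
      j+1-1≡j : ∀ j → j ℤ.+ + 1 ℤ.- + 1 ≡ j
      j+1-1≡j = ℤ-Solver.solve-∀
      shifted : Σ± (suc n) (λ j → B-term n m (j ℤ.- + 1)) ≈ ΣB n m
      shifted = trans
        (sym (Σ±-shift-vanishing (suc n) (λ j → B-term n m (j ℤ.- + 1)) (B-term n m)
                (λ j → reflexive (cong (B-term n m) (≡.sym (j+1-1≡j j))))
                (B-vanishes (-[1+ n ] ℤ.- + 1) μ≤n (s≤s (ℕₚ.m≤n⇒m≤1+n (ℕₚ.m≤m+n n 0))))
                (B-vanishes (+ suc n) μ≤n (ℕₚ.n<1+n n))))
        (B-drop-ends μ≤n)

    ΣB-suc-even : ∀ m → B-Step (m ℕ.+ m) m (suc m)
    ΣB-suc-even m =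
      trans (Σ±-linear (suc n) _ (B-term-suc-even m)) (+-cong (B-drop-ends μ≤n) (*-congˡ (A-drop-ends μ≤n)))
      where
      n = m ℕ.+ m
      μ≤n = ℕₚ.m≤m+n m m

    ΣA-suc-odd : ∀ m → A-Step (suc (m ℕ.+ m)) (suc m) (suc m)
    ΣA-suc-odd m =
      trans (Σ±-linear (suc n) _ (A-term-suc-odd m)) (+-cong (A-drop-ends μ≤n) (*-congˡ (B-drop-ends μ≤n)))
      where
      n = suc (m ℕ.+ m)
      μ≤n = s≤s (ℕₚ.m≤m+n m m)

    ΣB-suc-odd : ∀ m → B-Step (suc (m ℕ.+ m)) (suc m) (suc m)
    ΣB-suc-odd m = trans (Σ±-linear (suc n) _ (B-term-suc-odd m)) (+-cong (B-drop-ends μ≤n) (*-congˡ shifted))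
      where
      n = suc (m ℕ.+ m)
      μ≤n = s≤s (ℕₚ.m≤m+n m m)
      shifted : Σ± (suc n) (λ j → A-term n (suc m) (j ℤ.+ + 1)) ≈ ΣA n (suc m)
      shifted = trans
        (Σ±-shift-vanishing (suc n) (A-term n (suc m)) (λ j → A-term n (suc m) (j ℤ.+ + 1)) (λ j → refl)
           (A-vanishes -[1+ n ] μ≤n (ℕₚ.n<1+n n))
           (A-vanishes (+ suc (suc n)) μ≤n (ℕₚ.m≤n⇒m≤1+n (ℕₚ.n<1+n n))))
        (A-drop-ends μ≤n)

    ΣA-suc : ∀ n → A-Step n ⌈ n /2⌉ ⌈ suc n /2⌉
    ΣA-suc n with parity n
    ... | even m = ≡.subst₂ (A-Step (m ℕ.+ m)) (ℕₚ.n≡⌈n+n/2⌉ m) (1+m≡⌈1+m+m/2⌉ m) (ΣA-suc-even m)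
    ... | odd m = ≡.subst₂ (A-Step (suc (m ℕ.+ m))) (1+m≡⌈1+m+m/2⌉ m) (1+m≡⌈2+m+m/2⌉ m) (ΣA-suc-odd m)

    ΣB-suc : ∀ n → B-Step n ⌈ n /2⌉ ⌈ suc n /2⌉
    ΣB-suc n with parity n
    ... | even m = ≡.subst₂ (B-Step (m ℕ.+ m)) (ℕₚ.n≡⌈n+n/2⌉ m) (1+m≡⌈1+m+m/2⌉ m) (ΣB-suc-even m)
    ... | odd m = ≡.subst₂ (B-Step (suc (m ℕ.+ m))) (1+m≡⌈1+m+m/2⌉ m) (1+m≡⌈2+m+m/2⌉ m) (ΣB-suc-odd m)

    Sbar-odd : ℕ → Carrier
    Sbar-odd n = ΣB n ⌈ n /2⌉

    Sbar≈ΣA : ∀ n → Sbar R q n ≈ ΣA n ⌈ n /2⌉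
    Sbar≈ΣA n = trans (Σ<-as-Σ± n (A-term n (suc n ℕ./ 2))) (reflexive (cong (ΣA n) (n/2≡⌊n/2⌋ (suc n))))

    Sbar-suc : ∀ n → Sbar R q (suc n) ≈ Sbar R q n + q ^ suc n * Sbar-odd n
    Sbar-suc n = trans (Sbar≈ΣA (suc n)) (trans (ΣA-suc n) (+-congʳ (sym (Sbar≈ΣA n))))

    Sbar-odd-suc : ∀ n → Sbar-odd (suc n) ≈ Sbar-odd n + q ^ n * Sbar R q n
    Sbar-odd-suc n = trans (ΣB-suc n) (+-congˡ (*-congˡ (sym (Sbar≈ΣA n))))

mainTheorem3 : ∀ {c ℓ} (R : CommutativeRing c ℓ) (q : CommutativeRing.Carrier R) (n : ℕ) →
    let open CommutativeRing R in
    ((_⊖_ R (S R q (suc (suc n))) ((1# + q) * S R q (suc n)) + (_⊖_ R q (pow R q (2 ℕ.* n ℕ.+ 2))) * S R q n) ≈ 0#)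
    × ((_⊖_ R (Sbar R q (suc (suc n))) ((1# + q) * Sbar R q (suc n)) + (_⊖_ R q (pow R q (2 ℕ.* n ℕ.+ 2))) * Sbar R q n) ≈ 0#)
mainTheorem3 R q n =
    coupled-recurrence R q (S R q) (S-odd R q) (S-suc R q) (S-odd-suc R q) n
  , coupled-recurrence R q (Sbar R q) (Sbar-odd R q) (Sbar-suc R q) (Sbar-odd-suc R q) n
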